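{- There exists a universal constant $K_0$ such that for all positive integers $s$, $$\sum_{0\le k\le s/2}(1+t_k^2)\,p_k\le K_0,$$ where $p_k=\binom{s-k}{k}/\mathrm{Fib}_{s+1}$ and $t_k=5^{3/4}(k-k_0)/\sqrt{s}$.
   Context: $\mathrm{Fib}_{s+1}=\sum_{0\le j\le s/2}\binom{s-j}{j}$ (the Fibonacci number, with $\mathrm{Fib}_1=\mathrm{Fib}_2=1$), so $(p_k)_{0\le k\le s/2}$ is a probability distribution. $c_0=(5-\sqrt5)/10$ and $k_0=\lfloor c_0 s\rfloor$. -}

module Defs where

open import Data.Nat using (ℕ; zero; suc; _+_; _*_; _∸_; _^_; _≤_; _≤?_; ∣_-_∣; _/_)
open import Data.Nat.Combinatorics using (_C_)
open import Data.List using (List; map; upTo)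
open import Data.Nat.ListAction using (sum)
open import Data.Product using (_×_)
open import Relation.Nullary using (yes; no)
open import Relation.Nullary.Decidable using (_×-dec_)

fib : ℕ → ℕ
fib zero = zero
fib (suc zero) = suc zero
fib (suc (suc n)) = fib (suc n) + fib n

-- k ≤ c₀ s  with c₀ = (5 - √5)/10, i.e.  10k ≤ (5 - √5) s,
-- i.e.  √5 s ≤ 5s - 10k, written exactly over ℕ as
--   10k ≤ 5s  and  5 s² ≤ (5s - 10k)².
BelowC0 : ℕ → ℕ → Set
BelowC0 s k = (10 * k ≤ 5 * s) × (5 * (s * s) ≤ (5 * s ∸ 10 * k) * (5 * s ∸ 10 * k))

largestBelow : ℕ → ℕ → ℕ
largestBelow s zero = zero
largestBelow s (suc n) with (10 * suc n ≤? 5 * s) ×-dec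
                            (5 * (s * s) ≤? (5 * s ∸ 10 * suc n) * (5 * s ∸ 10 * suc n))
... | yes _ = suc n
... | no _  = largestBelow s n

-- k₀ = ⌊ c₀ s ⌋  (note c₀ s ≤ s)
k0 : ℕ → ℕ
k0 s = largestBelow s s

range : ℕ → List ℕ
range s = upTo (suc (s / 2))

-- s · Fib_{s+1} · Σ_k p_k  =  Σ_k s · C(s-k,k)
sumA : ℕ → ℕ
sumA s = sum (map (λ k → s * ((s ∸ k) C k)) (range s))

-- s · Fib_{s+1} · Σ_k t_k² p_k  =  √5 · sumB s, since t_k² = 5√5 (k-k₀)²/s
sumB : ℕ → ℕ
sumB s = sum (map (λ k → 5 * (∣ k - k0 s ∣ ^ 2) * ((s ∸ k) C k)) (range s))

{-# OPTIONS --safe #-}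
module Submission where

-- Write a = Fib_s, b = Fib_{s+1} and C k = C(s−k, k).  Pascal's rule along the diagonal,
-- C(s+1−k, k+1) = C(s−k, k+1) + C(s−k, k), gives every moment Σ_k h(k) C k a Fibonacci-type
-- recurrence in s, so Σ C k = b while 5·Σ k C k and 25·Σ k² C k are polynomials in s, a, b.
-- Completing the square, 100 b Σ (k − k₀)² C k = d² + 100 b²·Var with d = 10 b (k₀ − mean).
-- Cassini's identity b² − ab − a² = ±1 bounds the variance term by O(s b²).  For the offset,
-- write x = 5s − 10k₀: then d = s(b + 2a) − x b + 2a, and both (b + 2a)/b and x/s approximate
-- √5 (by Cassini (b + 2a)² = 5b² ∓ 4, and by the choice of k₀ (x − 10)² ≤ 5s² ≤ x²), whence
-- |d| ≤ 12 b.  So Σ (k − k₀)² C k ≤ 2 s b against Σ s C k = s b, and K₀ = 24 works since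
-- 5·10² ≤ 23².

open import Defs

module Moments where

  open import Data.Nat.Base
    using (ℕ; zero; suc; _+_; _*_; _∸_; _^_; _≤_; _<_; _≤′_; ≤′-refl; ≤′-step; ∣_-_∣; _/_; _%_; z≤n; s≤s; z<s)
  open import Data.Nat.Properties
  open import Data.Nat.Combinatorics using (_C_; nCk+nC[k+1]≡[n+1]C[k+1])
  open import Data.Nat.Combinatorics.Specification using (k>n⇒nCk≡0)
  open import Data.Nat.DivMod using (m≡m%n+[m/n]*n; m%n<n; m/n≤m)
  open import Data.Nat.ListAction using (sum)
  open import Data.Nat.ListAction.Properties using (sum-++)
  open import Data.Nat.Tactic.RingSolver using (solve-∀)
  open import Data.List.Base using (map; applyUpTo; [_]; _∷ʳ_)
  open import Data.List.Properties using (applyUpTo-∷ʳ; map-upTo)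
  open import Data.Sum.Base using (inj₁; inj₂)
  open import Function.Base using (id; _∘_)
  open import Relation.Binary.PropositionalEquality using (_≡_; refl; sym; trans; cong; cong₂; subst; _≗_; module ≡-Reasoning)
  open import Relation.Nullary.Decidable using (yes; no)
  open import Algebra.Properties.CommutativeSemigroup +-commutativeSemigroup using (interchange)

  sum-applyUpTo-cong : ∀ n {f g : ℕ → ℕ} → f ≗ g → sum (applyUpTo f n) ≡ sum (applyUpTo g n)
  sum-applyUpTo-cong zero    f≗g = refl
  sum-applyUpTo-cong (suc n) f≗g = cong₂ _+_ (f≗g 0) (sum-applyUpTo-cong n (f≗g ∘ suc))

  sum-applyUpTo-+ : ∀ n (f g : ℕ → ℕ) →
    sum (applyUpTo (λ k → f k + g k) n) ≡ sum (applyUpTo f n) + sum (applyUpTo g n)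
  sum-applyUpTo-+ zero    f g = refl
  sum-applyUpTo-+ (suc n) f g = trans
    (cong (f 0 + g 0 +_) (sum-applyUpTo-+ n (f ∘ suc) (g ∘ suc)))
    (interchange (f 0) (g 0) (sum (applyUpTo (f ∘ suc) n)) (sum (applyUpTo (g ∘ suc) n)))

  sum-applyUpTo-* : ∀ n c (f : ℕ → ℕ) → sum (applyUpTo (λ k → c * f k) n) ≡ c * sum (applyUpTo f n)
  sum-applyUpTo-* zero    c f = sym (*-zeroʳ c)
  sum-applyUpTo-* (suc n) c f = trans
    (cong (c * f 0 +_) (sum-applyUpTo-* n c (f ∘ suc)))
    (sym (*-distribˡ-+ c (f 0) (sum (applyUpTo (f ∘ suc) n))))

  sum-applyUpTo-trim : ∀ (f : ℕ → ℕ) {m n} → m ≤′ n → (∀ k → m ≤ k → f k ≡ 0) →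
    sum (applyUpTo f n) ≡ sum (applyUpTo f m)
  sum-applyUpTo-trim f ≤′-refl _ = refl
  sum-applyUpTo-trim f {m} (≤′-step {n} m≤′n) vanish = begin
    sum (applyUpTo f (suc n))         ≡⟨ cong sum (applyUpTo-∷ʳ f n) ⟨
    sum (applyUpTo f n ∷ʳ f n)        ≡⟨ sum-++ (applyUpTo f n) [ f n ] ⟩
    sum (applyUpTo f n) + (f n + 0)   ≡⟨ cong (λ z → sum (applyUpTo f n) + (z + 0)) (vanish n (≤′⇒≤ m≤′n)) ⟩
    sum (applyUpTo f n) + 0           ≡⟨ +-identityʳ _ ⟩
    sum (applyUpTo f n)               ≡⟨ sum-applyUpTo-trim f m≤′n vanish ⟩
    sum (applyUpTo f m)               ∎
    where open ≡-Reasoning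

  diag : ℕ → ℕ → ℕ
  diag s k = (s ∸ k) C k

  diag-vanish : ∀ {s k} → s ∸ k < k → diag s k ≡ 0
  diag-vanish = k>n⇒nCk≡0

  diag-beyond : ∀ {s k} → s ≤ k → 0 < k → diag s k ≡ 0
  diag-beyond {s} {k} s≤k 0<k = diag-vanish (subst (_< k) (sym (m≤n⇒m∸n≡0 s≤k)) 0<k)

  diag-pascal : ∀ s k → diag (2 + s) (1 + k) ≡ diag (1 + s) (1 + k) + diag s k
  diag-pascal s k with k ≤? s
  ... | yes k≤s = begin
    (suc s ∸ k) C suc k              ≡⟨ cong (_C suc k) (+-∸-assoc 1 k≤s) ⟩
    suc (s ∸ k) C suc k              ≡⟨ nCk+nC[k+1]≡[n+1]C[k+1] (s ∸ k) k ⟨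
    (s ∸ k) C k + (s ∸ k) C suc k    ≡⟨ +-comm ((s ∸ k) C k) _ ⟩
    (s ∸ k) C suc k + (s ∸ k) C k    ∎
    where open ≡-Reasoning
  ... | no k≰s = trans (diag-beyond (s≤s s<k) z<s)
                       (sym (cong₂ _+_ (diag-beyond (s≤s (<⇒≤ s<k)) z<s) (diag-beyond (<⇒≤ s<k) (≤-<-trans z≤n s<k))))
    where s<k = ≰⇒> k≰s

  -- Σ_{k ≤ s} h(k) C(s−k, k).  The terms with k > s/2 vanish (moment-range); summing up to s
  -- keeps moment-rec free of parity cases.
  moment : ℕ → (ℕ → ℕ) → ℕ
  moment s h = sum (applyUpTo (λ k → h k * diag s k) (suc s))

  moment-cong : ∀ s {f g : ℕ → ℕ} → f ≗ g → moment s f ≡ moment s g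
  moment-cong s f≗g = sum-applyUpTo-cong (suc s) (λ k → cong (_* diag s k) (f≗g k))

  moment-+ : ∀ s (f g : ℕ → ℕ) → moment s (λ k → f k + g k) ≡ moment s f + moment s g
  moment-+ s f g = trans
    (sum-applyUpTo-cong (suc s) (λ k → *-distribʳ-+ (diag s k) (f k) (g k)))
    (sum-applyUpTo-+ (suc s) (λ k → f k * diag s k) (λ k → g k * diag s k))

  moment-* : ∀ s c (f : ℕ → ℕ) → moment s (λ k → c * f k) ≡ c * moment s f
  moment-* s c f = trans
    (sum-applyUpTo-cong (suc s) (λ k → *-assoc c (f k) (diag s k)))
    (sum-applyUpTo-* (suc s) c (λ k → f k * diag s k))

  moment-const : ∀ s c → moment s (λ _ → c) ≡ c * moment s (λ _ → 1)
  moment-const s c = trans (moment-cong s (λ _ → sym (*-identityʳ c))) (moment-* s c (λ _ → 1))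

  moment-rec : ∀ s h → moment (2 + s) h ≡ moment (1 + s) h + moment s (h ∘ suc)
  moment-rec s h = begin
    h 0 * 1 + sum (applyUpTo (λ k → h (suc k) * diag (2 + s) (suc k)) (2 + s))
      ≡⟨ cong (h 0 * 1 +_) (trans (sum-applyUpTo-cong (2 + s) pascal) (sum-applyUpTo-+ (2 + s) f g)) ⟩
    h 0 * 1 + (sum (applyUpTo f (2 + s)) + sum (applyUpTo g (2 + s)))
      ≡⟨ cong (h 0 * 1 +_) (cong₂ _+_ (trim (λ 1+s≤k → diag-beyond (s≤s (<⇒≤ 1+s≤k)) z<s))
                                       (trim (λ 1+s≤k → diag-beyond (<⇒≤ 1+s≤k) (≤-<-trans z≤n 1+s≤k)))) ⟩
    h 0 * 1 + (sum (applyUpTo f (1 + s)) + sum (applyUpTo g (1 + s)))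
      ≡⟨ +-assoc (h 0 * 1) _ _ ⟨
    moment (1 + s) h + moment s (h ∘ suc) ∎
    where
    open ≡-Reasoning
    f g : ℕ → ℕ
    f k = h (suc k) * diag (1 + s) (suc k)
    g k = h (suc k) * diag s k
    pascal : ∀ k → h (suc k) * diag (2 + s) (suc k) ≡ f k + g k
    pascal k = trans (cong (h (suc k) *_) (diag-pascal s k)) (*-distribˡ-+ (h (suc k)) _ _)
    trim : ∀ {w : ℕ → ℕ} → (∀ {k} → 1 + s ≤ k → w k ≡ 0) →
           sum (applyUpTo (λ k → h (suc k) * w k) (2 + s)) ≡ sum (applyUpTo (λ k → h (suc k) * w k) (1 + s))
    trim w-vanish = sum-applyUpTo-trim _ (≤′-step ≤′-refl)
      (λ k 1+s≤k → trans (cong (h (suc k) *_) (w-vanish 1+s≤k)) (*-zeroʳ (h (suc k))))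

  moment-one : ∀ s → moment s (λ _ → 1) ≡ fib (suc s)
  moment-one zero          = refl
  moment-one (suc zero)    = refl
  moment-one (suc (suc s)) = trans (moment-rec s (λ _ → 1)) (cong₂ _+_ (moment-one (suc s)) (moment-one s))

  first-moment-rec : ∀ s →
    moment (2 + s) id ≡ moment (1 + s) id + (moment s (λ _ → 1) + moment s id)
  first-moment-rec s = trans (moment-rec s id) (cong (moment (1 + s) id +_) (moment-+ s (λ _ → 1) id))

  second-moment-rec : ∀ s →
    moment (2 + s) (λ k → k * k) ≡
    moment (1 + s) (λ k → k * k) + ((moment s (λ _ → 1) + (moment s id + moment s id)) + moment s (λ k → k * k))
  second-moment-rec s = trans (moment-rec s (λ k → k * k)) (cong (moment (1 + s) (λ k → k * k) +_) (begin
    moment s (λ k → suc k * suc k)                        ≡⟨ moment-cong s square-suc ⟩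
    moment s (λ k → (1 + (k + k)) + k * k)                ≡⟨ moment-+ s (λ k → 1 + (k + k)) (λ k → k * k) ⟩
    moment s (λ k → 1 + (k + k)) + moment s (λ k → k * k) ≡⟨ cong (_+ moment s (λ k → k * k)) linear-part ⟩
    (moment s (λ _ → 1) + (moment s id + moment s id)) + moment s (λ k → k * k) ∎))
    where
    open ≡-Reasoning
    square-suc : ∀ k → suc k * suc k ≡ (1 + (k + k)) + k * k
    square-suc = solve-∀
    linear-part : moment s (λ k → 1 + (k + k)) ≡ moment s (λ _ → 1) + (moment s id + moment s id)
    linear-part = trans (moment-+ s (λ _ → 1) (λ k → k + k)) (cong (moment s (λ _ → 1) +_) (moment-+ s id id))

  ∣m-n∣²+2nm≡m*m+n*n : ∀ m n → ∣ m - n ∣ ^ 2 + 2 * n * m ≡ m * m + n * n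
  ∣m-n∣²+2nm≡m*m+n*n m n with ≤-total m n
  ... | inj₁ m≤n = subst (λ n → ∣ m - n ∣ ^ 2 + 2 * n * m ≡ m * m + n * n) (m+[n∸m]≡n m≤n) (below m (n ∸ m))
    where
    below : ∀ m d → ∣ m - m + d ∣ ^ 2 + 2 * (m + d) * m ≡ m * m + (m + d) * (m + d)
    below m d = trans (cong (λ e → e ^ 2 + 2 * (m + d) * m) (∣m-m+n∣≡n m d)) (expand m d)
      where
      expand : ∀ m d → d * (d * 1) + 2 * (m + d) * m ≡ m * m + (m + d) * (m + d)
      expand = solve-∀
  ... | inj₂ n≤m = subst (λ m → ∣ m - n ∣ ^ 2 + 2 * n * m ≡ m * m + n * n) (m+[n∸m]≡n n≤m) (above n (m ∸ n))
    where
    above : ∀ n d → ∣ n + d - n ∣ ^ 2 + 2 * n * (n + d) ≡ (n + d) * (n + d) + n * n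
    above n d = trans (cong (λ e → e ^ 2 + 2 * n * (n + d)) (trans (∣-∣-comm (n + d) n) (∣m-m+n∣≡n n d))) (expand n d)
      where
      expand : ∀ n d → d * (d * 1) + 2 * n * (n + d) ≡ (n + d) * (n + d) + n * n
      expand = solve-∀

  centred-moment : ∀ s j →
    moment s (λ k → ∣ k - j ∣ ^ 2) + 2 * j * moment s id ≡ moment s (λ k → k * k) + j * j * moment s (λ _ → 1)
  centred-moment s j = begin
    moment s (λ k → ∣ k - j ∣ ^ 2) + 2 * j * moment s id
      ≡⟨ cong (moment s (λ k → ∣ k - j ∣ ^ 2) +_) (moment-* s (2 * j) id) ⟨
    moment s (λ k → ∣ k - j ∣ ^ 2) + moment s (λ k → 2 * j * k)
      ≡⟨ moment-+ s (λ k → ∣ k - j ∣ ^ 2) (λ k → 2 * j * k) ⟨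
    moment s (λ k → ∣ k - j ∣ ^ 2 + 2 * j * k)
      ≡⟨ moment-cong s (λ k → ∣m-n∣²+2nm≡m*m+n*n k j) ⟩
    moment s (λ k → k * k + j * j)
      ≡⟨ moment-+ s (λ k → k * k) (λ _ → j * j) ⟩
    moment s (λ k → k * k) + moment s (λ _ → j * j)
      ≡⟨ cong (moment s (λ k → k * k) +_) (moment-const s (j * j)) ⟩
    moment s (λ k → k * k) + j * j * moment s (λ _ → 1) ∎
    where open ≡-Reasoning

  half-range-vanish : ∀ s k → suc (s / 2) ≤ k → s ∸ k < k
  half-range-vanish s k@(suc _) 1+s/2≤k = m<n+o⇒m∸n<o s k (begin-strict
    s                       ≡⟨ m≡m%n+[m/n]*n s 2 ⟩
    s % 2 + (s / 2) * 2     <⟨ +-monoˡ-< ((s / 2) * 2) (m%n<n s 2) ⟩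
    suc (s / 2) * 2         ≤⟨ *-monoˡ-≤ 2 1+s/2≤k ⟩
    k * 2                   ≡⟨ *-comm k 2 ⟩
    k + (k + 0)             ≡⟨ cong (k +_) (+-identityʳ k) ⟩
    k + k                   ∎)
    where open ≤-Reasoning

  moment-range : ∀ s h → sum (map (λ k → h k * diag s k) (range s)) ≡ moment s h
  moment-range s h = trans (cong sum (map-upTo g (suc (s / 2))))
    (sym (sum-applyUpTo-trim g (≤⇒≤′ (s≤s (m/n≤m s 2)))
      (λ k 1+s/2≤k → trans (cong (h k *_) (diag-vanish (half-range-vanish s k 1+s/2≤k))) (*-zeroʳ (h k)))))
    where
    g : ℕ → ℕ
    g k = h k * diag s k

  fib-mono : ∀ n → fib n ≤ fib (suc n)
  fib-mono zero    = z≤n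
  fib-mono (suc n) = m≤m+n (fib (suc n)) (fib n)

  fib-pos : ∀ n → 0 < fib (suc n)
  fib-pos zero    = z<s
  fib-pos (suc n) = <-≤-trans (fib-pos n) (fib-mono (suc n))

  n≤fib[1+n] : ∀ n → n ≤ fib (suc n)
  n≤fib[1+n] zero          = z≤n
  n≤fib[1+n] (suc zero)    = ≤-refl
  n≤fib[1+n] (suc (suc n)) = ≤-trans (+-mono-≤ (fib-pos n) (n≤fib[1+n] (suc n)))
                                      (≤-reflexive (+-comm (fib (suc n)) (fib (suc (suc n)))))

module Threshold where

  open import Data.Nat.Base using (zero; suc; _+_; _*_; _∸_; _≤_; _<_; z≤n; s≤s; s≤s⁻¹; z<s; >-nonZero)
  open import Data.Nat.Properties
  open import Data.Nat.Tactic.RingSolver using (solve-∀)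
  open import Data.Product.Base using (_,_; proj₁)
  open import Data.Sum.Base using (inj₁; inj₂)
  open import Relation.Binary.PropositionalEquality using (_≡_; _≢_; refl; sym; trans; cong; subst)
  open import Relation.Nullary.Decidable using (yes; no; _×-dec_)
  open import Relation.Nullary.Negation using (¬_)

  BelowC0-zero : ∀ s → BelowC0 s 0
  BelowC0-zero s = z≤n , subst (5 * (s * s) ≤_) (sym (expand s)) (m≤m+n (5 * (s * s)) (20 * (s * s)))
    where
    expand : ∀ s → 5 * s * (5 * s) ≡ 5 * (s * s) + 20 * (s * s)
    expand = solve-∀

  largestBelow-≤ : ∀ s n → largestBelow s n ≤ n
  largestBelow-≤ s zero = z≤n
  largestBelow-≤ s (suc n)
    with (10 * suc n ≤? 5 * s) ×-dec (5 * (s * s) ≤? (5 * s ∸ 10 * suc n) * (5 * s ∸ 10 * suc n))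
  ... | yes _ = ≤-refl
  ... | no _  = m≤n⇒m≤1+n (largestBelow-≤ s n)

  largestBelow-below : ∀ s n → BelowC0 s (largestBelow s n)
  largestBelow-below s zero = BelowC0-zero s
  largestBelow-below s (suc n)
    with (10 * suc n ≤? 5 * s) ×-dec (5 * (s * s) ≤? (5 * s ∸ 10 * suc n) * (5 * s ∸ 10 * suc n))
  ... | yes below = below
  ... | no _      = largestBelow-below s n

  largestBelow-maximal : ∀ s n {j} → largestBelow s n < j → j ≤ n → ¬ BelowC0 s j
  largestBelow-maximal s zero () z≤n
  largestBelow-maximal s (suc n) {j} lt j≤1+n
    with (10 * suc n ≤? 5 * s) ×-dec (5 * (s * s) ≤? (5 * s ∸ 10 * suc n) * (5 * s ∸ 10 * suc n))
  ... | yes _ = λ _ → <⇒≱ lt j≤1+n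
  ... | no not-below with m≤n⇒m<n∨m≡n j≤1+n
  ...   | inj₁ j<1+n = largestBelow-maximal s n lt (s≤s⁻¹ j<1+n)
  ...   | inj₂ refl  = not-below

  k0≤c₀s : ∀ s → BelowC0 s (k0 s)
  k0≤c₀s s = largestBelow-below s s

  k0<s : ∀ s → 1 ≤ s → k0 s < s
  k0<s s 1≤s = ≤∧≢⇒< (largestBelow-≤ s s) k0≢s
    where
    instance _ = >-nonZero 1≤s
    k0≢s : k0 s ≢ s
    k0≢s k0≡s = <⇒≱ (*-monoˡ-< s (m<m+n 5 {5} z<s)) (proj₁ (subst (BelowC0 s) k0≡s (k0≤c₀s s)))

  k0-maximal : ∀ s → 1 ≤ s → ¬ BelowC0 s (suc (k0 s))
  k0-maximal s 1≤s = largestBelow-maximal s s ≤-refl (k0<s s 1≤s)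

  c₀s≤k0+1 : ∀ s → 1 ≤ s → (5 * s ∸ 10 * k0 s ∸ 10) * (5 * s ∸ 10 * k0 s ∸ 10) ≤ 5 * (s * s)
  c₀s≤k0+1 s 1≤s = subst (λ z → z * z ≤ 5 * (s * s)) (sym z≡) (<⇒≤ (≰⇒> (λ 5s²≤z² →
    k0-maximal s 1≤s (<⇒≤ (m∸n≢0⇒n<m (z≢0 5s²≤z²)) , 5s²≤z²))))
    where
    k = k0 s
    z≡ : 5 * s ∸ 10 * k ∸ 10 ≡ 5 * s ∸ 10 * suc k
    z≡ = trans (∸-+-assoc (5 * s) (10 * k) 10) (cong (5 * s ∸_) (trans (+-comm (10 * k) 10) (sym (*-suc 10 k))))
    z≢0 : 5 * (s * s) ≤ (5 * s ∸ 10 * suc k) * (5 * s ∸ 10 * suc k) → 5 * s ∸ 10 * suc k ≢ 0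
    z≢0 5s²≤z² z≡0 = <⇒≱ (*-mono-≤ (s≤s (z≤n {4})) (*-mono-≤ 1≤s 1≤s)) (subst (λ z → 5 * (s * s) ≤ z * z) z≡0 5s²≤z²)

module Variance where

  open Moments using (moment; moment-one; first-moment-rec; second-moment-rec; centred-moment; fib-mono; fib-pos; n≤fib[1+n])
  open Threshold using (k0≤c₀s; c₀s≤k0+1)
  open import Data.Nat.Base as ℕ using (ℕ; zero; suc; z≤n)
  open import Data.Integer.Base using (ℤ; +_; 0ℤ; 1ℤ; -1ℤ; _+_; _-_; _*_; -_; _≤_; +≤+; nonNegative; positive)
  open import Data.Integer.Properties
    using (+-mono-≤; ≤-trans; i≤j⇒0≤j-i; 0≤i-j⇒j≤i; *-zeroʳ; *-monoˡ-≤-nonNeg; *-monoʳ-<-pos; pos-*; [+m]-[+n]≡m⊖n; ⊖-≥; drop‿+≤+; _≤?_; ≰⇒>; <⇒≤; <⇒≱; ≤-<-trans; module ≤-Reasoning)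
  open import Data.Integer.Tactic.RingSolver using (solve-∀)
  open import Data.Product.Base using (_×_; _,_; proj₁; proj₂)
  import Data.Nat.Properties as NP
  open import Data.Sum.Base using (_⊎_; inj₁; inj₂)
  open import Function.Base using (id)
  open import Relation.Binary.PropositionalEquality using (_≡_; refl; sym; trans; cong; cong₂; subst; subst₂; module ≡-Reasoning)
  open import Relation.Nullary.Decidable using (yes; no)
  open import Relation.Nullary.Negation using (contradiction)

  cassini : ℤ → ℤ → ℤ
  cassini a b = b * b - a * b - a * a

  cassini-flip : ∀ a b → cassini b (b + a) ≡ - cassini a b
  cassini-flip = expanded
    where
    expanded : ∀ a b → (b + a) * (b + a) - b * (b + a) - b * b ≡ - (b * b - a * b - a * a)
    expanded = solve-∀

  fib-cassini : ∀ n → cassini (+ fib n) (+ fib (suc n)) ≡ 1ℤ ⊎ cassini (+ fib n) (+ fib (suc n)) ≡ -1ℤ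
  fib-cassini zero = inj₁ refl
  fib-cassini (suc n) with fib-cassini n
  ... | inj₁ e≡1  = inj₂ (trans (cassini-flip (+ fib n) (+ fib (suc n))) (cong -_ e≡1))
  ... | inj₂ e≡-1 = inj₁ (trans (cassini-flip (+ fib n) (+ fib (suc n))) (cong -_ e≡-1))

  cassini-bounds : ∀ {e} → e ≡ 1ℤ ⊎ e ≡ -1ℤ → 0ℤ ≤ 1ℤ - e × 0ℤ ≤ 1ℤ + e
  cassini-bounds (inj₁ refl) = +≤+ z≤n , +≤+ z≤n
  cassini-bounds (inj₂ refl) = +≤+ z≤n , +≤+ z≤n

  μ₁ : ℤ → ℤ → ℤ → ℤ
  μ₁ s a b = + 2 * s * b - a - s * a

  μ₂ : ℤ → ℤ → ℤ → ℤ
  μ₂ s a b = a + + 3 * s * b + + 5 * s * s * b - + 4 * s * a - + 5 * s * s * a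

  μ₁-rec : ∀ s a b → μ₁ (+ 1 + s) b (b + a) + (+ 5 * b + μ₁ s a b) ≡ μ₁ (+ 1 + (+ 1 + s)) (b + a) (b + a + b)
  μ₁-rec = expanded
    where
    expanded : ∀ s a b →
      (+ 2 * (+ 1 + s) * (b + a) - b - (+ 1 + s) * b) + (+ 5 * b + (+ 2 * s * b - a - s * a))
      ≡ + 2 * (+ 1 + (+ 1 + s)) * (b + a + b) - (b + a) - (+ 1 + (+ 1 + s)) * (b + a)
    expanded = solve-∀

  μ₂-rec : ∀ s a b →
    μ₂ (+ 1 + s) b (b + a) + (+ 25 * b + + 10 * μ₁ s a b + μ₂ s a b) ≡ μ₂ (+ 1 + (+ 1 + s)) (b + a) (b + a + b)
  μ₂-rec = expanded
    where
    expanded : ∀ s a b →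
      (b + + 3 * (+ 1 + s) * (b + a) + + 5 * (+ 1 + s) * (+ 1 + s) * (b + a)
         - + 4 * (+ 1 + s) * b - + 5 * (+ 1 + s) * (+ 1 + s) * b)
      + (+ 25 * b + + 10 * (+ 2 * s * b - a - s * a)
         + (a + + 3 * s * b + + 5 * s * s * b - + 4 * s * a - + 5 * s * s * a))
      ≡ (b + a) + + 3 * (+ 1 + (+ 1 + s)) * (b + a + b)
        + + 5 * (+ 1 + (+ 1 + s)) * (+ 1 + (+ 1 + s)) * (b + a + b)
        - + 4 * (+ 1 + (+ 1 + s)) * (b + a) - + 5 * (+ 1 + (+ 1 + s)) * (+ 1 + (+ 1 + s)) * (b + a)
    expanded = solve-∀

  first-moment : ∀ s → + 5 * + moment s id ≡ μ₁ (+ s) (+ fib s) (+ fib (suc s))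
  first-moment zero          = refl
  first-moment (suc zero)    = refl
  first-moment (suc (suc s)) = begin
    + 5 * + moment (2 ℕ.+ s) id
      ≡⟨ cong (λ m → + 5 * + m) (first-moment-rec s) ⟩
    + 5 * (+ moment (1 ℕ.+ s) id + (+ moment s (λ _ → 1) + + moment s id))
      ≡⟨ distribute (+ moment (1 ℕ.+ s) id) (+ moment s (λ _ → 1)) (+ moment s id) ⟩
    + 5 * + moment (1 ℕ.+ s) id + (+ 5 * + moment s (λ _ → 1) + + 5 * + moment s id)
      ≡⟨ cong₂ (λ u v → u + (+ 5 * + v + + 5 * + moment s id)) (first-moment (suc s)) (moment-one s) ⟩
    μ₁ (+ suc s) b (b + a) + (+ 5 * b + + 5 * + moment s id)
      ≡⟨ cong (λ v → μ₁ (+ suc s) b (b + a) + (+ 5 * b + v)) (first-moment s) ⟩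
    μ₁ (+ suc s) b (b + a) + (+ 5 * b + μ₁ (+ s) a b)
      ≡⟨ μ₁-rec (+ s) a b ⟩
    μ₁ (+ suc (suc s)) (b + a) (b + a + b) ∎
    where
    open ≡-Reasoning
    a = + fib s
    b = + fib (suc s)
    distribute : ∀ x y z → + 5 * (x + (y + z)) ≡ + 5 * x + (+ 5 * y + + 5 * z)
    distribute = solve-∀

  second-moment : ∀ s → + 25 * + moment s (λ k → k ℕ.* k) ≡ μ₂ (+ s) (+ fib s) (+ fib (suc s))
  second-moment zero          = refl
  second-moment (suc zero)    = refl
  second-moment (suc (suc s)) = begin
    + 25 * + moment (2 ℕ.+ s) sq
      ≡⟨ cong (λ m → + 25 * + m) (second-moment-rec s) ⟩
    + 25 * (+ moment (1 ℕ.+ s) sq + ((+ m₀ + (+ m₁ + + m₁)) + + moment s sq))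
      ≡⟨ distribute (+ moment (1 ℕ.+ s) sq) (+ m₀) (+ m₁) (+ moment s sq) ⟩
    + 25 * + moment (1 ℕ.+ s) sq + (+ 25 * + m₀ + + 10 * (+ 5 * + m₁) + + 25 * + moment s sq)
      ≡⟨ cong₂ _+_ (second-moment (suc s))
           (cong₂ _+_ (cong₂ (λ u v → + 25 * u + + 10 * v) (cong +_ (moment-one s)) (first-moment s))
                      (second-moment s)) ⟩
    μ₂ (+ suc s) b (b + a) + (+ 25 * b + + 10 * μ₁ (+ s) a b + μ₂ (+ s) a b)
      ≡⟨ μ₂-rec (+ s) a b ⟩
    μ₂ (+ suc (suc s)) (b + a) (b + a + b) ∎
    where
    open ≡-Reasoning
    a = + fib s
    b = + fib (suc s)
    sq : ℕ → ℕ
    sq k = k ℕ.* k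
    m₀ = moment s (λ _ → 1)
    m₁ = moment s id
    distribute : ∀ p q r t → + 25 * (p + ((q + (r + r)) + t)) ≡ + 25 * p + (+ 25 * q + + 10 * (+ 5 * r) + + 25 * t)
    distribute = solve-∀

  0≤i*j : ∀ {i j} → 0ℤ ≤ i → 0ℤ ≤ j → 0ℤ ≤ i * j
  0≤i*j {i} {j} 0≤i 0≤j = subst (_≤ i * j) (*-zeroʳ i) (*-monoˡ-≤-nonNeg i {{nonNegative 0≤i}} 0≤j)

  0≤n*i : ∀ n {i} → 0ℤ ≤ i → 0ℤ ≤ + n * i
  0≤n*i n = 0≤i*j {+ n} (+≤+ z≤n)

  i*i≤j*j⇒i≤j : ∀ {i j} → 0ℤ ≤ j → i * i ≤ j * j → i ≤ j
  i*i≤j*j⇒i≤j {i} {j} 0≤j i*i≤j*j with i ≤? j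
  ... | yes i≤j = i≤j
  ... | no  i≰j = contradiction i*i≤j*j (<⇒≱ (begin-strict
    j * j  ≤⟨ *-monoˡ-≤-nonNeg j {{nonNegative 0≤j}} (<⇒≤ j<i) ⟩
    j * i  <⟨ *-monoʳ-<-pos i {{positive (≤-<-trans 0≤j j<i)}} j<i ⟩
    i * i  ∎))
    where
    open ≤-Reasoning
    j<i = ≰⇒> i≰j

  -- Both bounds rest on (b + 2a)² = 5b² − 4 · cassini a b.
  s[b+2a]≤xb+2s : ∀ {s a b x} → 0ℤ ≤ s → 0ℤ ≤ b → 0ℤ ≤ x → 0ℤ ≤ 1ℤ + cassini a b →
    + 5 * (s * s) ≤ x * x → s * (b + + 2 * a) ≤ x * b + + 2 * s
  s[b+2a]≤xb+2s {s} {a} {b} {x} 0≤s 0≤b 0≤x 0≤1+e 5s²≤x² =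
    i*i≤j*j⇒i≤j (+-mono-≤ (0≤i*j 0≤x 0≤b) (0≤n*i 2 0≤s))
      (0≤i-j⇒j≤i (subst (0ℤ ≤_) (sym (difference s a b x))
        (+-mono-≤ (+-mono-≤ (0≤i*j (0≤i*j 0≤b 0≤b) (i≤j⇒0≤j-i 5s²≤x²))
                            (0≤i*j (0≤n*i 4 (0≤i*j 0≤s 0≤s)) 0≤1+e))
                  (0≤i*j (0≤i*j (0≤n*i 4 0≤x) 0≤b) 0≤s))))
    where
    difference : ∀ s a b x →
      (x * b + + 2 * s) * (x * b + + 2 * s) - s * (b + + 2 * a) * (s * (b + + 2 * a))
      ≡ b * b * (x * x - + 5 * (s * s)) + + 4 * (s * s) * (+ 1 + (b * b - a * b - a * a)) + + 4 * x * b * s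
    difference = solve-∀

  yb≤s[b+2a]+2s : ∀ {s a b y} → 0ℤ ≤ s → 0ℤ ≤ a → 0ℤ ≤ b → 0ℤ ≤ 1ℤ - cassini a b →
    y * y ≤ + 5 * (s * s) → y * b ≤ s * (b + + 2 * a) + + 2 * s
  yb≤s[b+2a]+2s {s} {a} {b} {y} 0≤s 0≤a 0≤b 0≤1-e y²≤5s² =
    i*i≤j*j⇒i≤j (+-mono-≤ (0≤i*j 0≤s 0≤b+2a) (0≤n*i 2 0≤s))
      (0≤i-j⇒j≤i (subst (0ℤ ≤_) (sym (difference s a b y))
        (+-mono-≤ (+-mono-≤ (0≤i*j (0≤i*j 0≤b 0≤b) (i≤j⇒0≤j-i y²≤5s²))
                            (0≤i*j (0≤n*i 4 (0≤i*j 0≤s 0≤s)) 0≤1-e))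
                  (0≤i*j (0≤i*j (0≤n*i 4 0≤s) 0≤s) 0≤b+2a))))
    where
    0≤b+2a = +-mono-≤ 0≤b (0≤n*i 2 0≤a)
    difference : ∀ s a b y →
      (s * (b + + 2 * a) + + 2 * s) * (s * (b + + 2 * a) + + 2 * s) - y * b * (y * b)
      ≡ b * b * (+ 5 * (s * s) - y * y) + + 4 * (s * s) * (+ 1 - (b * b - a * b - a * a)) + + 4 * s * s * (b + + 2 * a)
    difference = solve-∀

  -- For x = 5s − 10k this is 10 k b − 2 μ₁ s a b, i.e. 10 b (k − mean).
  offset : ℤ → ℤ → ℤ → ℤ → ℤ
  offset s a b x = s * (b + + 2 * a) + + 2 * a - x * b

  offset-bounds : ∀ {s a b x y} → 0ℤ ≤ a → a ≤ b → s ≤ b → 0ℤ ≤ b →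
    s * (b + + 2 * a) ≤ x * b + + 2 * s → y * b ≤ s * (b + + 2 * a) + + 2 * s → x ≤ + 10 + y →
    0ℤ ≤ + 12 * b - offset s a b x × 0ℤ ≤ + 12 * b + offset s a b x
  offset-bounds {s} {a} {b} {x} {y} 0≤a a≤b s≤b 0≤b upper lower x≤10+y =
    subst (0ℤ ≤_) (sym (below s a b x))
      (+-mono-≤ (+-mono-≤ (+-mono-≤ (i≤j⇒0≤j-i upper) (0≤n*i 2 (i≤j⇒0≤j-i s≤b)))
                          (0≤n*i 2 (i≤j⇒0≤j-i a≤b)))
                (0≤n*i 8 0≤b)) ,
    subst (0ℤ ≤_) (sym (above s a b x y))
      (+-mono-≤ (+-mono-≤ (+-mono-≤ (i≤j⇒0≤j-i lower) (0≤i*j (i≤j⇒0≤j-i x≤10+y) 0≤b))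
                          (0≤n*i 2 (i≤j⇒0≤j-i s≤b)))
                (0≤n*i 2 0≤a))
    where
    below : ∀ s a b x → + 12 * b - (s * (b + + 2 * a) + + 2 * a - x * b)
      ≡ (x * b + + 2 * s - s * (b + + 2 * a)) + + 2 * (b - s) + + 2 * (b - a) + + 8 * b
    below = solve-∀
    above : ∀ s a b x y → + 12 * b + (s * (b + + 2 * a) + + 2 * a - x * b)
      ≡ (s * (b + + 2 * a) + + 2 * s - y * b) + (+ 10 + y - x) * b + + 2 * (b - s) + + 2 * a
    above = solve-∀

  -- 4 (b μ₂ − μ₁²), i.e. 100 b² times the variance.
  ν : ℤ → ℤ → ℤ → ℤ
  ν s a b = + 4 * (s * s) * cassini a b + + 4 * s * (+ 3 * (b * b) - + 2 * (a * a)) + + 4 * a * (b - a)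

  variance-identity : ∀ {s a b k x m₁ m₂ t} →
    + 5 * m₁ ≡ μ₁ s a b → + 25 * m₂ ≡ μ₂ s a b → t + + 2 * k * m₁ ≡ m₂ + k * k * b → x ≡ + 5 * s - + 10 * k →
    + 100 * b * t ≡ offset s a b x * offset s a b x + ν s a b
  variance-identity {s} {a} {b} {k} {x} {m₁} {m₂} {t} h₁ h₂ hₜ refl = begin
    + 100 * b * t
      ≡⟨ eliminate-t b k m₁ t ⟩
    + 100 * b * (t + + 2 * k * m₁) - + 40 * k * b * (+ 5 * m₁)
      ≡⟨ cong₂ (λ u v → + 100 * b * u - + 40 * k * b * v) hₜ h₁ ⟩
    + 100 * b * (m₂ + k * k * b) - + 40 * k * b * μ₁ s a b
      ≡⟨ regroup b k m₂ (+ 40 * k * b * μ₁ s a b) ⟩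
    + 4 * b * (+ 25 * m₂) + + 100 * b * (k * k * b) - + 40 * k * b * μ₁ s a b
      ≡⟨ cong (λ v → + 4 * b * v + + 100 * b * (k * k * b) - + 40 * k * b * μ₁ s a b) h₂ ⟩
    + 4 * b * μ₂ s a b + + 100 * b * (k * k * b) - + 40 * k * b * μ₁ s a b
      ≡⟨ complete-square s a b k ⟩
    offset s a b x * offset s a b x + ν s a b ∎
    where
    open ≡-Reasoning
    eliminate-t : ∀ b k m₁ t → + 100 * b * t ≡ + 100 * b * (t + + 2 * k * m₁) - + 40 * k * b * (+ 5 * m₁)
    eliminate-t = solve-∀
    regroup : ∀ b k m₂ u → + 100 * b * (m₂ + k * k * b) - u ≡ + 4 * b * (+ 25 * m₂) + + 100 * b * (k * k * b) - u
    regroup = solve-∀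
    complete-square : ∀ s a b k →
      + 4 * b * (a + + 3 * s * b + + 5 * s * s * b - + 4 * s * a - + 5 * s * s * a)
        + + 100 * b * (k * k * b) - + 40 * k * b * (+ 2 * s * b - a - s * a)
      ≡ (s * (b + + 2 * a) + + 2 * a - (+ 5 * s - + 10 * k) * b) * (s * (b + + 2 * a) + + 2 * a - (+ 5 * s - + 10 * k) * b)
        + (+ 4 * (s * s) * (b * b - a * b - a * a) + + 4 * s * (+ 3 * (b * b) - + 2 * (a * a)) + + 4 * a * (b - a))
    complete-square = solve-∀

  variance-bound : ∀ {s a b d t} → 1ℤ ≤ s → s ≤ b → 0ℤ ≤ a → a ≤ b → 0ℤ ≤ 1ℤ - cassini a b →
    0ℤ ≤ + 12 * b - d → 0ℤ ≤ + 12 * b + d → + 100 * b * t ≡ d * d + ν s a b →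
    + 100 * b * t ≤ + 100 * b * (+ 2 * s * b)
  variance-bound {s} {a} {b} {d} 1≤s s≤b 0≤a a≤b 0≤1-e 0≤12b-d 0≤12b+d identity =
    subst (_≤ + 100 * b * (+ 2 * s * b)) (sym identity) (0≤i-j⇒j≤i (subst (0ℤ ≤_) (sym (slack s a b d))
      (+-mono-≤ (+-mono-≤ (+-mono-≤ (+-mono-≤ (+-mono-≤ (+-mono-≤ (+-mono-≤
        (0≤i*j 0≤12b-d 0≤12b+d)
        (0≤i*j (0≤n*i 4 (0≤i*j 0≤s 0≤s)) 0≤1-e))
        (0≤i*j (0≤n*i 4 (i≤j⇒0≤j-i s≤b)) (+-mono-≤ 0≤b 0≤s)))
        (0≤i*j (0≤n*i 8 0≤s) (0≤i*j 0≤a 0≤a)))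
        (0≤n*i 4 (0≤i*j 0≤a 0≤a)))
        (0≤i*j (0≤n*i 4 0≤b) (i≤j⇒0≤j-i a≤b)))
        (0≤i*j (0≤n*i 152 (0≤i*j 0≤b 0≤b)) (i≤j⇒0≤j-i 1≤s)))
        (0≤i*j (0≤n*i 36 0≤s) (0≤i*j 0≤b 0≤b)))))
    where
    0≤s = ≤-trans (+≤+ z≤n) 1≤s
    0≤b = ≤-trans 0≤s s≤b
    slack : ∀ s a b d →
      + 100 * b * (+ 2 * s * b)
        - (d * d + (+ 4 * (s * s) * (b * b - a * b - a * a) + + 4 * s * (+ 3 * (b * b) - + 2 * (a * a)) + + 4 * a * (b - a)))
      ≡ (+ 12 * b - d) * (+ 12 * b + d) + + 4 * (s * s) * (+ 1 - (b * b - a * b - a * a)) + + 4 * (b - s) * (b + s)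
        + + 8 * s * (a * a) + + 4 * (a * a) + + 4 * b * (b - a) + + 152 * (b * b) * (s - + 1) + + 36 * s * (b * b)
    slack = solve-∀

  pos-*³ : ∀ l m n → + (l ℕ.* m ℕ.* n) ≡ + l * + m * + n
  pos-*³ l m n = trans (pos-* (l ℕ.* m) n) (cong (_* + n) (pos-* l m))

  pos-∸ : ∀ {m n} → n ℕ.≤ m → + (m ℕ.∸ n) ≡ + m - + n
  pos-∸ {m} {n} n≤m = sym (trans ([+m]-[+n]≡m⊖n m n) (⊖-≥ n≤m))

  k0-offset : ℕ → ℤ
  k0-offset s = offset (+ s) (+ fib s) (+ fib (suc s)) (+ (5 ℕ.* s ℕ.∸ 10 ℕ.* k0 s))

  k0-offset-bounds : ∀ s → 1 ℕ.≤ s →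
    0ℤ ≤ + 12 * + fib (suc s) - k0-offset s × 0ℤ ≤ + 12 * + fib (suc s) + k0-offset s
  k0-offset-bounds s 1≤s = offset-bounds {y = + y} (+≤+ z≤n) (+≤+ (fib-mono s)) (+≤+ (n≤fib[1+n] s)) (+≤+ z≤n)
    (s[b+2a]≤xb+2s {+ s} {+ a} {+ b} {+ x} (+≤+ z≤n) (+≤+ z≤n) (+≤+ z≤n) (proj₂ e-bounds) 5s²≤x²)
    (yb≤s[b+2a]+2s {+ s} {+ a} {+ b} {+ y} (+≤+ z≤n) (+≤+ z≤n) (+≤+ z≤n) (proj₁ e-bounds) y²≤5s²)
    (+≤+ (NP.m≤n+m∸n x 10))
    where
    a = fib s
    b = fib (suc s)
    x = 5 ℕ.* s ℕ.∸ 10 ℕ.* k0 s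
    y = x ℕ.∸ 10
    e-bounds = cassini-bounds (fib-cassini s)
    5s² : + (5 ℕ.* (s ℕ.* s)) ≡ + 5 * (+ s * + s)
    5s² = trans (pos-* 5 (s ℕ.* s)) (cong (+ 5 *_) (pos-* s s))
    5s²≤x² : + 5 * (+ s * + s) ≤ + x * + x
    5s²≤x² = subst₂ _≤_ 5s² (pos-* x x) (+≤+ (proj₂ (k0≤c₀s s)))
    y²≤5s² : + y * + y ≤ + 5 * (+ s * + s)
    y²≤5s² = subst₂ _≤_ (pos-* y y) 5s² (+≤+ (c₀s≤k0+1 s 1≤s))

  centred-moment-bound : ∀ s → 1 ℕ.≤ s → moment s (λ j → ℕ.∣ j - k0 s ∣ ℕ.^ 2) ℕ.≤ 2 ℕ.* s ℕ.* fib (suc s)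
  centred-moment-bound s 1≤s = NP.*-cancelˡ-≤ (100 ℕ.* b) {{NP.m*n≢0 100 b}}
    (drop‿+≤+ (subst₂ _≤_ (sym (pos-*³ 100 b t))
      (sym (trans (pos-* (100 ℕ.* b) (2 ℕ.* s ℕ.* b)) (cong₂ _*_ (pos-* 100 b) (pos-*³ 2 s b))))
      (variance-bound (+≤+ 1≤s) (+≤+ (n≤fib[1+n] s)) (+≤+ z≤n) (+≤+ (fib-mono s)) (proj₁ (cassini-bounds (fib-cassini s)))
        (proj₁ (k0-offset-bounds s 1≤s)) (proj₂ (k0-offset-bounds s 1≤s)) identity)))
    where
    a = fib s
    b = fib (suc s)
    instance _ = ℕ.>-nonZero (fib-pos s)
    k = k0 s
    m₁ = moment s id
    m₂ = moment s (λ j → j ℕ.* j)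
    t = moment s (λ j → ℕ.∣ j - k ∣ ℕ.^ 2)
    t-rel : + t + + 2 * + k * + m₁ ≡ + m₂ + + k * + k * + b
    t-rel = trans (cong (λ u → + t + u) (sym (pos-*³ 2 k m₁)))
           (trans (cong +_ (trans (centred-moment s k) (cong (λ m → m₂ ℕ.+ k ℕ.* k ℕ.* m) (moment-one s))))
                  (cong (λ u → + m₂ + u) (pos-*³ k k b)))
    x≡ : + (5 ℕ.* s ℕ.∸ 10 ℕ.* k) ≡ + 5 * + s - + 10 * + k
    x≡ = trans (pos-∸ (proj₁ (k0≤c₀s s))) (cong₂ _-_ (pos-* 5 s) (pos-* 10 k))
    identity : + 100 * + b * + t ≡ k0-offset s * k0-offset s + ν (+ s) (+ a) (+ b)
    identity = variance-identity {+ s} {+ a} {+ b} {+ k} {+ (5 ℕ.* s ℕ.∸ 10 ℕ.* k)} {+ m₁} {+ m₂} {+ t}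
      (first-moment s) (second-moment s) t-rel x≡

open import Data.Nat.Base using (ℕ; _+_; _*_; _∸_; _^_; _≤_; ∣_-_∣)
open import Data.Nat.Properties
open import Data.Nat.Tactic.RingSolver using (solve-∀)
open import Data.Product.Base using (∃; _×_; _,_)
open import Relation.Binary.PropositionalEquality using (_≡_; refl; sym; cong; subst; module ≡-Reasoning)
open Moments using (moment; moment-range; moment-const; moment-*; moment-one)
open Variance using (centred-moment-bound)

sumA≡fib[s+1]*s : ∀ s → sumA s ≡ fib (s + 1) * s
sumA≡fib[s+1]*s s = begin
  sumA s                       ≡⟨ moment-range s (λ _ → s) ⟩
  moment s (λ _ → s)           ≡⟨ moment-const s s ⟩
  s * moment s (λ _ → 1)       ≡⟨ cong (s *_) (moment-one s) ⟩
  s * fib (1 + s)              ≡⟨ cong (λ n → s * fib n) (+-comm 1 s) ⟩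
  s * fib (s + 1)              ≡⟨ *-comm s (fib (s + 1)) ⟩
  fib (s + 1) * s              ∎
  where open ≡-Reasoning

sumB≤10*fib[s+1]*s : ∀ s → 1 ≤ s → sumB s ≤ 10 * (fib (s + 1) * s)
sumB≤10*fib[s+1]*s s 1≤s = begin
  sumB s                                   ≡⟨ moment-range s (λ k → 5 * ∣ k - k0 s ∣ ^ 2) ⟩
  moment s (λ k → 5 * ∣ k - k0 s ∣ ^ 2)    ≡⟨ moment-* s 5 (λ k → ∣ k - k0 s ∣ ^ 2) ⟩
  5 * moment s (λ k → ∣ k - k0 s ∣ ^ 2)    ≤⟨ *-monoʳ-≤ 5 (centred-moment-bound s 1≤s) ⟩
  5 * (2 * s * fib (1 + s))                ≡⟨ regroup s (fib (1 + s)) ⟩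
  10 * (fib (1 + s) * s)                   ≡⟨ cong (λ n → 10 * (fib n * s)) (+-comm 1 s) ⟩
  10 * (fib (s + 1) * s)                   ∎
  where
  open ≤-Reasoning
  regroup : ∀ s b → 5 * (2 * s * b) ≡ 10 * (b * s)
  regroup = solve-∀

K₀=24-suffices : ∀ {u A B} → A ≡ u → B ≤ 10 * u → (A ≤ 24 * u) × (5 * (B ^ 2) ≤ (24 * u ∸ A) ^ 2)
K₀=24-suffices {u} {B = B} refl B≤10u = m≤m+n u (23 * u) , (begin
  5 * (B ^ 2)                    ≤⟨ *-monoʳ-≤ 5 (^-monoˡ-≤ 2 B≤10u) ⟩
  5 * ((10 * u) ^ 2)             ≡⟨ expand u ⟩
  500 * (u * u)                  ≤⟨ m≤m+n (500 * (u * u)) (29 * (u * u)) ⟩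
  500 * (u * u) + 29 * (u * u)   ≡⟨ expand′ u ⟩
  (23 * u) ^ 2                   ≡⟨ cong (_^ 2) (m+n∸m≡n u (23 * u)) ⟨
  (24 * u ∸ u) ^ 2               ∎)
  where
  open ≤-Reasoning
  expand : ∀ u → 5 * ((10 * u) * ((10 * u) * 1)) ≡ 500 * (u * u)
  expand = solve-∀
  expand′ : ∀ u → 500 * (u * u) + 29 * (u * u) ≡ (23 * u) * ((23 * u) * 1)
  expand′ = solve-∀

lemma6 : ∃ λ (K0 : ℕ) → ∀ (s : ℕ) → 1 ≤ s →
    (sumA s ≤ K0 * fib (s + 1) * s)
    × (5 * (sumB s ^ 2) ≤ (K0 * fib (s + 1) * s ∸ sumA s) ^ 2)
lemma6 = 24 , λ s 1≤s →
  subst (λ n → (sumA s ≤ n) × (5 * (sumB s ^ 2) ≤ (n ∸ sumA s) ^ 2)) (sym (*-assoc 24 (fib (s + 1)) s))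
        (K₀=24-suffices (sumA≡fib[s+1]*s s) (sumB≤10*fib[s+1]*s s 1≤s))
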